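{- For every fixed $p\in(0,1)$, the total time that pdqsort (as described in the context) spends on bad partitions when sorting an array of length $n$ is $O(n\log n)$; here the time spent on bad partitions is the sum, over all calls whose partition step is bad, of the work done in that call excluding its recursive calls.
   Context: Setting. The input is an array $A[0..n-1]$ ($n\ge1$) of elements compared by a strict weak ordering $<$; $a,b$ compare equal if neither $a<b$ nor $b<a$; $a\le b$ means "not $b<a$". Time counts elementary operations, each comparison or element move costing $O(1)$. pdqsort has fixed constants: insertion-sort threshold $c\ge3$, bad-partition parameter $p\in(0,1)$, and a constant move bound. It is the following recursive procedure acting in place on contiguous subarrays $A[a..b)$, each call carrying an integer counter $t$; the top-level call is on $A[0..n)$ with $t=\lfloor\log_2 n\rfloor$. For $a>0$ the predecessor of $A[a..b)$ is the element at position $a-1$. A call on $A[a..b)$ with $m=b-a$ does: (1) if $m\le c$, insertion sort $A[a..b)$ and return; (2) if $t=0$, heapsort $A[a..b)$ and return; (3) select a pivot $q$ as the median of at least three sampled elements of $A[a..b)$ by a deterministic rule using $O(1)$ comparisons, and move it to position $a$; (4) if $a>0$ and the predecessor compares equal to $q$, apply partition_left: in $O(m)$ time rearrange so that $q$ ends at a position $r$, all of $A[a..r)$ are $\le q$, all of $A[r+1..b)$ are $>q$; otherwise apply partition_right: in $O(m)$ time rearrange so that $q$ ends at $r$, all of $A[a..r)$ are $<q$, all of $A[r+1..b)$ are $\ge q$; (5) the partition is bad if $\min(r-a,b-r-1)<pm$, good otherwise; if bad, set $t:=t-1$ and swap $O(1)$ elements at fixed relative positions inside each part; (6) if partition_right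 was applied, the partition is good, and no element other than the pivot was moved, run on both parts an insertion sort aborting after the constant number of moves; if both complete, return; (7) if partition_left was applied, recurse only on $A[r+1..b)$; otherwise recurse on $A[a..r)$ and on $A[r+1..b)$, each with counter $t$. The counter is local to each call, not global.
   Formalization: The bad-partition parameter p ranges only over the rationals in (0,1). -}

module Defs where

open import Data.Nat using (ℕ; zero; suc; _+_; _*_; _≤_; _<_; _⊔_; _⊓_)
open import Data.List using (List; []; _∷_; _++_; length)
open import Data.List.Relation.Unary.All using (All)
open import Data.List.Relation.Binary.Permutation.Propositional using (_↭_)
open import Data.Maybe using (Maybe; just; nothing)
open import Data.Product using (Σ; _×_; _,_)
open import Relation.Nullary using (¬_)
open import Relation.Binary.PropositionalEquality using (_≡_)

record IsStrictWeakOrder {A : Set} (_≺_ : A → A → Set) : Set where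
  field
    irrefl  : ∀ {x} → ¬ (x ≺ x)
    trans   : ∀ {x y z} → x ≺ y → y ≺ z → x ≺ z
    incomp-trans : ∀ {x y z} → ¬ (x ≺ y) → ¬ (y ≺ x) → ¬ (y ≺ z) → ¬ (z ≺ y)
                 → ¬ (x ≺ z) × ¬ (z ≺ x)

-- Model of the executions of pdqsort.
--   _≺_      : the strict weak ordering on elements
--   c        : insertion-sort threshold
--   num den  : the bad-partition parameter p = num / den
--   K        : constant in the O(m) bound on the work of a (bad) call,
--              excluding recursive calls (pivot selection, partition, swaps)
module PDQ {A : Set} (_≺_ : A → A → Set) (c num den K : ℕ) where

  _≈_ : A → A → Set
  a ≈ b = ¬ (a ≺ b) × ¬ (b ≺ a)

  _≼_ : A → A → Set
  a ≼ b = ¬ (b ≺ a)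

  PredEq : Maybe A → A → Set
  PredEq pr q = Σ A λ x → pr ≡ just x × x ≈ q

  LeftParts : A → List A → List A → Set
  LeftParts q ls rs = All (λ x → x ≼ q) ls × All (λ x → q ≺ x) rs

  RightParts : A → List A → List A → Set
  RightParts q ls rs = All (λ x → x ≺ q) ls × All (λ x → q ≼ x) rs

  -- the partition of a subarray of length m into parts of sizes l and r
  -- (r - a = l, b - r - 1 = r) is bad iff  min(l, r) < p m
  Bad : ℕ → List A → List A → Set
  Bad m ls rs = den * (length ls ⊓ length rs) < num * m

  -- Run pr t xs w : there is an execution of the call on a subarray with
  -- contents xs, predecessor pr (nothing when a = 0) and counter t, in which
  -- the total work spent on bad partitions (over this call and all calls it
  -- transitively makes, each bad call counted without its recursive calls) is w.
  data Run : Maybe A → ℕ → List A → ℕ → Set where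
    -- (1) insertion sort
    small : ∀ {pr t xs} → length xs ≤ c → Run pr t xs 0
    -- (2) heapsort
    heap  : ∀ {pr xs} → c < length xs → Run pr 0 xs 0
    -- (3)+(4) partition_right, (5) good, (6) both aborting insertion sorts complete
    right-good-early : ∀ {pr t xs q ls rs}
      → c < length xs → ¬ PredEq pr q
      → xs ↭ (ls ++ q ∷ rs) → RightParts q ls rs
      → ¬ Bad (length xs) ls rs
      → Run pr (suc t) xs 0
    right-good : ∀ {pr t xs q ls rs w₁ w₂}
      → c < length xs → ¬ PredEq pr q
      → xs ↭ (ls ++ q ∷ rs) → RightParts q ls rs
      → ¬ Bad (length xs) ls rs
      → Run pr (suc t) ls w₁ → Run (just q) (suc t) rs w₂
      → Run pr (suc t) xs (w₁ + w₂)
    -- (3)+(4) partition_right, (5) bad: counter decremented, elements inside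
    -- each part rearranged, (7) recurse on both parts
    right-bad : ∀ {pr t xs q ls rs ls′ rs′ w w₁ w₂}
      → c < length xs → ¬ PredEq pr q
      → xs ↭ (ls ++ q ∷ rs) → RightParts q ls rs
      → Bad (length xs) ls rs
      → ls′ ↭ ls → rs′ ↭ rs
      → w ≤ K * length xs
      → Run pr t ls′ w₁ → Run (just q) t rs′ w₂
      → Run pr (suc t) xs (w + w₁ + w₂)
    left-good : ∀ {pr t xs q ls rs w₂}
      → c < length xs → PredEq pr q
      → xs ↭ (ls ++ q ∷ rs) → LeftParts q ls rs
      → ¬ Bad (length xs) ls rs
      → Run (just q) (suc t) rs w₂
      → Run pr (suc t) xs w₂
    left-bad : ∀ {pr t xs q ls rs ls′ rs′ w w₂}
      → c < length xs → PredEq pr q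
      → xs ↭ (ls ++ q ∷ rs) → LeftParts q ls rs
      → Bad (length xs) ls rs
      → ls′ ↭ ls → rs′ ↭ rs
      → w ≤ K * length xs
      → Run (just q) t rs′ w₂
      → Run pr (suc t) xs (w + w₂)

{-# OPTIONS --safe #-}
module Submission where

-- Every bad partition of a subarray of length m costs at most K m and
-- decrements the counter, while the parts a call recurses on are together
-- shorter than the subarray.  Hence the bad-partition work of a call with
-- counter t on m elements is at most K m t (each element pays K for each of
-- the at most t bad calls containing it), and the top-level counter is
-- ⌊log₂ n⌋.

open import Defs
open import Data.Nat using (ℕ; suc; _+_; _*_; _≤_; _<_; z≤n)
open import Data.Nat.Properties
  using (≤-trans; ≤-reflexive; <⇒≤; +-mono-≤; +-assoc;
         *-monoʳ-≤; *-monoˡ-≤; *-distribˡ-+; *-distribʳ-+; *-suc; +-monoʳ-<; n<1+n;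
         module ≤-Reasoning)
open import Data.Nat.Logarithm using (⌊log₂_⌋)
open import Data.List using (List; length; _∷_; _++_)
open import Data.List.Properties using (length-++)
open import Data.List.Relation.Binary.Permutation.Propositional using (_↭_)
open import Data.List.Relation.Binary.Permutation.Propositional.Properties using (↭-length)
open import Data.Maybe using (nothing)
open import Data.Product using (Σ; _,_)
open import Relation.Binary.PropositionalEquality using (sym; cong; cong₂)

parts-length-< : ∀ {A : Set} {xs ls rs : List A} {q : A}
  → xs ↭ ls ++ q ∷ rs → length ls + length rs < length xs
parts-length-< {xs = xs} {ls} {rs} {q} p = begin-strict
  length ls + length rs         <⟨ +-monoʳ-< (length ls) (n<1+n (length rs)) ⟩
  length ls + length (q ∷ rs)   ≡⟨ sym (length-++ ls) ⟩
  length (ls ++ q ∷ rs)         ≡⟨ sym (↭-length p) ⟩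
  length xs                     ∎
  where open ≤-Reasoning

permuted-parts-length-< : ∀ {A : Set} {xs ls rs ls′ rs′ : List A} {q : A}
  → xs ↭ ls ++ q ∷ rs → ls′ ↭ ls → rs′ ↭ rs → length ls′ + length rs′ < length xs
permuted-parts-length-< p pl pr =
  ≤-trans (≤-reflexive (cong suc (cong₂ _+_ (↭-length pl) (↭-length pr)))) (parts-length-< p)

module _ (K : ℕ) (t : ℕ) where

  parts-work-≤ : ∀ l r {n w₁ w₂} → w₁ ≤ K * (l * t) → w₂ ≤ K * (r * t) → l + r ≤ n
    → w₁ + w₂ ≤ K * (n * t)
  parts-work-≤ l r {n} {w₁} {w₂} b₁ b₂ l+r≤n = begin
    w₁ + w₂                    ≤⟨ +-mono-≤ b₁ b₂ ⟩
    K * (l * t) + K * (r * t)  ≡⟨ sym (*-distribˡ-+ K (l * t) (r * t)) ⟩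
    K * (l * t + r * t)        ≡⟨ cong (K *_) (sym (*-distribʳ-+ t l r)) ⟩
    K * ((l + r) * t)          ≤⟨ *-monoʳ-≤ K (*-monoˡ-≤ t l+r≤n) ⟩
    K * (n * t)                ∎
    where open ≤-Reasoning

  bad-call-work-≤ : ∀ {n w w′} → w ≤ K * n → w′ ≤ K * (n * t) → w + w′ ≤ K * (n * suc t)
  bad-call-work-≤ {n} {w} {w′} b b′ = begin
    w + w′               ≤⟨ +-mono-≤ b b′ ⟩
    K * n + K * (n * t)  ≡⟨ sym (*-distribˡ-+ K n (n * t)) ⟩
    K * (n + n * t)      ≡⟨ cong (K *_) (sym (*-suc n t)) ⟩
    K * (n * suc t)      ∎
    where open ≤-Reasoning

module _ {A : Set} (_≺_ : A → A → Set) (c num den K : ℕ) where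
  open PDQ _≺_ c num den K

  bad-work-≤ : ∀ {pr t xs w} → Run pr t xs w → w ≤ K * (length xs * t)
  bad-work-≤ (small _) = z≤n
  bad-work-≤ (heap _) = z≤n
  bad-work-≤ (right-good-early _ _ _ _ _) = z≤n
  bad-work-≤ {t = t} (right-good {ls = ls} {rs = rs} _ _ p _ _ run₁ run₂) =
    parts-work-≤ K t (length ls) (length rs) (bad-work-≤ run₁) (bad-work-≤ run₂)
      (<⇒≤ (parts-length-< p))
  bad-work-≤ {t = suc t}
    (right-bad {ls′ = ls′} {rs′} {w} {w₁} {w₂} _ _ p _ _ pl pr w≤Km run₁ run₂)
    rewrite +-assoc w w₁ w₂ =
    bad-call-work-≤ K t w≤Km
      (parts-work-≤ K t (length ls′) (length rs′) (bad-work-≤ run₁) (bad-work-≤ run₂)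
        (<⇒≤ (permuted-parts-length-< p pl pr)))
  -- partition_left does not recurse on its left part, which enters with work 0.
  bad-work-≤ {t = t} (left-good {ls = ls} {rs = rs} _ _ p _ _ run₂) =
    parts-work-≤ K t (length ls) (length rs) z≤n (bad-work-≤ run₂)
      (<⇒≤ (parts-length-< p))
  bad-work-≤ {t = suc t} (left-bad {ls′ = ls′} {rs′} _ _ p _ _ pl pr w≤Km run₂) =
    bad-call-work-≤ K t w≤Km
      (parts-work-≤ K t (length ls′) (length rs′) z≤n (bad-work-≤ run₂)
        (<⇒≤ (permuted-parts-length-< p pl pr)))

lemma5 : (num den : ℕ) → 0 < num → num < den → (c : ℕ) → 3 ≤ c → (K : ℕ)
    → Σ ℕ λ C → Σ ℕ λ N →
    {A : Set} (_≺_ : A → A → Set) → IsStrictWeakOrder _≺_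
    → (xs : List A) → N ≤ length xs → (w : ℕ)
    → PDQ.Run _≺_ c num den K nothing ⌊log₂ length xs ⌋ xs w
    → w ≤ C * (length xs * ⌊log₂ length xs ⌋)
lemma5 num den _ _ c _ K = K , 0 , λ _≺_ _ _ _ _ → bad-work-≤ _≺_ c num den K
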